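{- Let $G=(V,E,L)$ be a $\Sigma$-labeled directed graph. There is an infinite repeated string occurring in $G$ if and only if there is a string $RS^\omega\in\Sigma^\omega$, with $R\in\Sigma^*$ and $S\in\Sigma^+$, spelled by two distinct infinite walks $rs^\omega$ and $r's'^\omega$ of $G$, where $r,r'$ are finite walks with $L(r)=L(r')=R$ and $s,s'$ are finite nonempty walks with $L(s)=L(s')=S$ (and the concatenations are walks of $G$).
   Context: A $\Sigma$-labeled graph is $G=(V,E,L)$ with $(V,E)$ a finite directed graph and $L\colon V\to\Sigma$. A walk is a finite or infinite sequence of vertices $(p_0,p_1,\dots)$ with $(p_i,p_{i+1})\in E$; its spelling is $L(p)=L(p_0)L(p_1)\cdots$. Walks are concatenated as sequences when the result is a walk; $s^\omega$ is the infinite repetition of $s$. Two walks $(p_i)$, $(q_i)$ are distinct if $p_i\ne q_i$ for some $i$. An (infinite) string is repeated in $G$ if it is spelled by two distinct (infinite) walks. $\Sigma^+$ is the set of nonempty finite strings, $\Sigma^\omega$ the set of infinite strings. -}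

module Defs where

open import Data.Nat using (ℕ; zero; suc)
open import Data.Nat.DivMod using (_%_; m%n<n)
open import Data.Fin using (Fin; fromℕ<)
open import Data.Bool using (Bool; true)
open import Data.List using (List; []; _∷_; length; lookup)
open import Data.List.NonEmpty using (List⁺; _∷_; toList)
open import Data.Product using (∃; ∃-syntax; _×_)
open import Relation.Binary.PropositionalEquality using (_≡_; _≢_)

record LGraph (Σ : Set) : Set where
  field
    n : ℕ
    E : Fin n → Fin n → Bool
    L : Fin n → Σ

Seq : Set → Set
Seq A = ℕ → A

cyc : {A : Set} → List⁺ A → Seq A
cyc (x ∷ xs) i = lookup (x ∷ xs) (fromℕ< (m%n<n i (suc (length xs))))

lasso : {A : Set} → List A → List⁺ A → Seq A
lasso []      s i       = cyc s i
lasso (x ∷ r) s zero    = x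
lasso (x ∷ r) s (suc i) = lasso r s i

module _ {Σ : Set} (G : LGraph Σ) where
  open LGraph G

  IsInfWalk : Seq (Fin n) → Set
  IsInfWalk p = ∀ i → E (p i) (p (suc i)) ≡ true

  Spells : Seq (Fin n) → Seq Σ → Set
  Spells p w = ∀ i → L (p i) ≡ w i

  Distinct : Seq (Fin n) → Seq (Fin n) → Set
  Distinct p q = ∃[ i ] (p i ≢ q i)

  InfRepeated : Seq Σ → Set
  InfRepeated w = ∃[ p ] ∃[ q ] (IsInfWalk p × IsInfWalk q × Distinct p q × Spells p w × Spells q w)

  HasInfRepeated : Set
  HasInfRepeated = ∃[ w ] InfRepeated w

-- Take two distinct walks p, q spelling the same infinite string, differing at
-- position i.  The pairs (p t , q t) range over the finite set V × V, so some pair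
-- recurs: (p j , q j) = (p (j+m+1) , q (j+m+1)) with i ≤ j.  Keeping positions
-- 0 … j+m of both walks and repeating the block j … j+m forever gives lasso walks
-- r s^ω and r′ s′^ω: the loops close because p and q return to their position-j
-- vertices, both spell the corresponding lasso of the common string, and they
-- still differ at position i.
module Submission where

open import Defs
open import Data.List using (List; map)
open import Data.List.NonEmpty using (List⁺) renaming (map to map⁺)
open import Data.Fin using (Fin)
open import Data.Product using (∃; ∃-syntax; _×_)
open import Function.Bundles using (_⇔_)
open import Relation.Binary.PropositionalEquality using (_≡_)

open import Data.Bool using (true)
open import Data.Fin using (toℕ; combine)
open import Data.Fin.Properties using (pigeonhole; combine-injective; toℕ-fromℕ<)
open import Data.List using (_∷_; applyUpTo)
open import Data.List.Properties using (lookup-applyUpTo; length-applyUpTo)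
import Data.List.NonEmpty as List⁺
open import Data.Nat using (ℕ; zero; suc; _+_; _≤_; _<_; z<s; s<s; _<?_)
open import Data.Nat.DivMod using (_%_; _/_; m%n<n; m≡m%n+[m/n]*n; [m+kn]%n≡m%n; m<n⇒m%n≡m; n%n≡0)
open import Data.Nat.Properties
  using (+-identityʳ; +-suc; +-assoc; n<1+n; m≤m+n; m≤n⇒m<n∨m≡n; m≤n⇒∃[o]m+o≡n; ≤-antisym; ≮⇒≥)
open import Data.Product using (_,_)
open import Data.Sum using (inj₁; inj₂)
open import Function using (id; _∘_)
open import Function.Bundles using (mk⇔)
open import Relation.Binary.PropositionalEquality using (refl; sym; trans; cong; cong₂; subst; subst₂; _≗_; module ≡-Reasoning)
open import Relation.Nullary using (yes; no)

private
  variable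
    A B C : Set

data BeforeOrAfter (j : ℕ) : ℕ → Set where
  before : ∀ {t} → t < j → BeforeOrAfter j t
  after  : ∀ u → BeforeOrAfter j (j + u)

beforeOrAfter : ∀ j t → BeforeOrAfter j t
beforeOrAfter zero    t       = after t
beforeOrAfter (suc j) zero    = before z<s
beforeOrAfter (suc j) (suc t) with beforeOrAfter j t
... | before t<j = before (s<s t<j)
... | after u    = after u

suc-%-suc : ∀ u m → suc u % suc m ≡ suc (u % suc m) % suc m
suc-%-suc u m = trans (cong (λ v → suc v % suc m) (m≡m%n+[m/n]*n u (suc m)))
                      ([m+kn]%n≡m%n (suc (u % suc m)) (u / suc m) (suc m))

suc-%-wrap : ∀ (g : ℕ → A) m → g 0 ≡ g (suc m) → ∀ u → g (suc (u % suc m)) ≡ g (suc u % suc m)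
suc-%-wrap g m g-period u with suc (u % suc m) <? suc m
... | yes below = cong g (sym (trans (suc-%-suc u m) (m<n⇒m%n≡m below)))
... | no ¬below = begin
  g (suc (u % suc m))          ≡⟨ cong g top ⟩
  g (suc m)                    ≡⟨ sym g-period ⟩
  g 0                          ≡⟨ cong g (sym (n%n≡0 (suc m))) ⟩
  g (suc m % suc m)            ≡⟨ cong (λ v → g (v % suc m)) (sym top) ⟩
  g (suc (u % suc m) % suc m)  ≡⟨ cong g (sym (suc-%-suc u m)) ⟩
  g (suc u % suc m)            ∎
  where
  open ≡-Reasoning
  top : suc (u % suc m) ≡ suc m
  top = ≤-antisym (m%n<n u (suc m)) (≮⇒≥ ¬below)

applyUpTo⁺ : (ℕ → A) → ℕ → List⁺ A
applyUpTo⁺ f m = f 0 List⁺.∷ applyUpTo (f ∘ suc) m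

map-applyUpTo-≗ : {g : B → C} {f : ℕ → B} {h : ℕ → C} →
                  g ∘ f ≗ h → ∀ n → map g (applyUpTo f n) ≡ applyUpTo h n
map-applyUpTo-≗ gf≗h zero    = refl
map-applyUpTo-≗ gf≗h (suc n) = cong₂ _∷_ (gf≗h 0) (map-applyUpTo-≗ (gf≗h ∘ suc) n)

map⁺-applyUpTo⁺-≗ : {g : B → C} {f : ℕ → B} {h : ℕ → C} →
                    g ∘ f ≗ h → ∀ m → map⁺ g (applyUpTo⁺ f m) ≡ applyUpTo⁺ h m
map⁺-applyUpTo⁺-≗ gf≗h m = cong₂ List⁺._∷_ (gf≗h 0) (map-applyUpTo-≗ (gf≗h ∘ suc) m)

cyc-applyUpTo⁺ : ∀ (f : ℕ → A) m u → cyc (applyUpTo⁺ f m) u ≡ f (u % suc m)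
cyc-applyUpTo⁺ f m u =
  trans (lookup-applyUpTo f (suc m) _)
        (trans (cong f (toℕ-fromℕ< _)) (cong (λ d → f (u % suc d)) (length-applyUpTo (f ∘ suc) m)))

lasso-applyUpTo-< : ∀ (f : ℕ → A) (s : List⁺ A) {j t} → t < j → lasso (applyUpTo f j) s t ≡ f t
lasso-applyUpTo-< f s {suc j} {zero}  _         = refl
lasso-applyUpTo-< f s {suc j} {suc t} (s<s t<j) = lasso-applyUpTo-< (f ∘ suc) s t<j

lasso-applyUpTo-+ : ∀ (f : ℕ → A) (s : List⁺ A) j u → lasso (applyUpTo f j) s (j + u) ≡ cyc s u
lasso-applyUpTo-+ f s zero    u = refl
lasso-applyUpTo-+ f s (suc j) u = lasso-applyUpTo-+ (f ∘ suc) s j u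

lassoAt : Seq A → ℕ → ℕ → Seq A
lassoAt f j m = lasso (applyUpTo f j) (applyUpTo⁺ (λ k → f (j + k)) m)

module _ (f : Seq A) {j : ℕ} (m : ℕ) where

  lassoAt-< : ∀ {t} → t < j → lassoAt f j m t ≡ f t
  lassoAt-< = lasso-applyUpTo-< f _

  lassoAt-+ : ∀ u → lassoAt f j m (j + u) ≡ f (j + u % suc m)
  lassoAt-+ u = trans (lasso-applyUpTo-+ f _ j u) (cyc-applyUpTo⁺ (λ k → f (j + k)) m u)

  lassoAt-≤ : ∀ {t} → t ≤ j → lassoAt f j m t ≡ f t
  lassoAt-≤ t≤j with m≤n⇒m<n∨m≡n t≤j
  ... | inj₁ t<j  = lassoAt-< t<j
  ... | inj₂ refl = subst (λ t → lassoAt f j m t ≡ f t) (+-identityʳ j) (lassoAt-+ 0)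

-- Every lasso is a reindexing of its sequence by the lasso of the indices.
foldAt : ℕ → ℕ → Seq ℕ
foldAt = lassoAt id

lassoAt-≗ : ∀ (f : Seq A) j m → lassoAt f j m ≗ f ∘ foldAt j m
lassoAt-≗ f j m t with beforeOrAfter j t
... | before t<j = trans (lassoAt-< f m t<j) (cong f (sym (lassoAt-< id m t<j)))
... | after u    = trans (lassoAt-+ f {j} m u) (cong f (sym (lassoAt-+ id {j} m u)))

lassoAt-natural : ∀ (g : A → B) (f : Seq A) {h : Seq B} →
                  g ∘ f ≗ h → ∀ j m → g ∘ lassoAt f j m ≗ lassoAt h j m
lassoAt-natural g f {h} gf≗h j m t =
  trans (cong g (lassoAt-≗ f j m t)) (trans (gf≗h _) (sym (lassoAt-≗ h j m t)))

foldAt-suc : ∀ (f : Seq A) j m → f j ≡ f (j + suc m) →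
             ∀ t → f (suc (foldAt j m t)) ≡ f (foldAt j m (suc t))
foldAt-suc f j m f-period t with beforeOrAfter j t
... | before t<j = cong f (trans (cong suc (lassoAt-< id m t<j)) (sym (lassoAt-≤ id m t<j)))
... | after u    = begin
  f (suc (foldAt j m (j + u)))  ≡⟨ cong (f ∘ suc) (lassoAt-+ id m u) ⟩
  f (suc (j + u % suc m))       ≡⟨ cong f (sym (+-suc j _)) ⟩
  f (j + suc (u % suc m))       ≡⟨ suc-%-wrap (λ k → f (j + k)) m
                                     (trans (cong f (+-identityʳ j)) f-period) u ⟩
  f (j + suc u % suc m)         ≡⟨ cong f (sym (lassoAt-+ id m (suc u))) ⟩
  f (foldAt j m (j + suc u))    ≡⟨ cong (f ∘ foldAt j m) (+-suc j u) ⟩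
  f (foldAt j m (suc (j + u)))  ∎
  where open ≡-Reasoning

lassoAt-step : ∀ (_~_ : A → A → Set) {f : Seq A} → (∀ t → f t ~ f (suc t)) →
               ∀ {j m} → f j ≡ f (j + suc m) → ∀ t → lassoAt f j m t ~ lassoAt f j m (suc t)
lassoAt-step _~_ {f} step {j} {m} f-period t =
  subst₂ _~_ (sym (lassoAt-≗ f j m t))
             (trans (foldAt-suc f j m f-period t) (sym (lassoAt-≗ f j m (suc t))))
             (step (foldAt j m t))

recurrence : ∀ {k} (f : ℕ → Fin k) i → ∃[ j ] ∃[ m ] (i ≤ j × f j ≡ f (j + suc m))
recurrence {k} f i with pigeonhole (n<1+n k) (λ x → f (i + toℕ x))
... | x , y , x<y , fx≡fy with m≤n⇒∃[o]m+o≡n x<y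
... | m , x+1+m≡y = i + toℕ x , m , m≤m+n i (toℕ x) , trans fx≡fy (cong f (sym shift))
  where
  shift : i + toℕ x + suc m ≡ i + toℕ y
  shift = trans (+-assoc i (toℕ x) (suc m)) (cong (i +_) (trans (+-suc (toℕ x) m) x+1+m≡y))

lemma1 : {Σ : Set} (G : LGraph Σ) →
    HasInfRepeated G ⇔
      (∃[ R ] ∃[ S ] ∃[ r ] ∃[ r′ ] ∃[ s ] ∃[ s′ ]
        (map (LGraph.L G) r ≡ R × map (LGraph.L G) r′ ≡ R ×
         map⁺ (LGraph.L G) s ≡ S × map⁺ (LGraph.L G) s′ ≡ S ×
         IsInfWalk G (lasso r s) × IsInfWalk G (lasso r′ s′) ×
         Distinct G (lasso r s) (lasso r′ s′) ×
         Spells G (lasso r s) (lasso R S) × Spells G (lasso r′ s′) (lasso R S)))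
lemma1 G = mk⇔
  (λ { (w , p , q , p-walk , q-walk , (i , pᵢ≢qᵢ) , p-spells , q-spells) →
    let j , m , i≤j , pairs-recur = recurrence (λ t → combine (p t) (q t)) i
        p-recurs , q-recurs = combine-injective (p j) (q j) _ _ pairs-recur
        loop : {X : Set} → Seq X → List⁺ X
        loop f = applyUpTo⁺ (λ k → f (j + k)) m
    in applyUpTo w j , loop w , applyUpTo p j , applyUpTo q j , loop p , loop q ,
       map-applyUpTo-≗ p-spells j , map-applyUpTo-≗ q-spells j ,
       map⁺-applyUpTo⁺-≗ (p-spells ∘ (j +_)) m , map⁺-applyUpTo⁺-≗ (q-spells ∘ (j +_)) m ,
       lassoAt-step Edge p-walk p-recurs , lassoAt-step Edge q-walk q-recurs ,
       (i , λ pᵢ≡qᵢ → pᵢ≢qᵢ (trans (sym (lassoAt-≤ p m i≤j)) (trans pᵢ≡qᵢ (lassoAt-≤ q m i≤j)))) ,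
       lassoAt-natural L p p-spells j m , lassoAt-natural L q q-spells j m })
  (λ { (R , S , r , r′ , s , s′ , _ , _ , _ , _ , r-walk , r′-walk , r≢r′ , r-spells , r′-spells) →
    lasso R S , lasso r s , lasso r′ s′ , r-walk , r′-walk , r≢r′ , r-spells , r′-spells })
  where
  open LGraph G
  Edge : Fin n → Fin n → Set
  Edge u v = E u v ≡ true
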